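{- Let $G$ be a cubic graph. A closed walk in $G$ is a reporter strand walk if and only if it is edge-spanning, orientable, and retraction-free.
   Context: Walks are directed. A reporter strand walk in $G$ is a closed walk that uses every edge of $G$ at least once and occurs as the boundary walk of a face in some orientable cellular embedding of $G$. A walk is edge-spanning if it uses every edge at least once; it is orientable if it uses each edge at most once in each direction. A retraction in a walk is an edge followed immediately by the same edge traversed in the opposite direction; a walk is retraction-free if it has no retraction. -}

module Defs where

open import Data.Nat using (ℕ; zero; suc)
open import Data.Fin using (Fin; zero; suc)
open import Data.Product using (Σ; ∃; _×_; _,_)
open import Data.Sum using (_⊎_)
open import Function using (_∘_)
open import Function.Bundles using (_↔_)
open import Relation.Binary.PropositionalEquality using (_≡_; _≢_)

-- Graphs (multigraphs, loops allowed) in dart / half-edge form.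
-- Vertices are Fin V, darts (directed edges) are Fin D; `rev` is the
-- fixed-point-free involution sending a dart to the same edge traversed
-- in the opposite direction; an edge is a pair {d , rev d}.

record Graph : Set where
  field
    V         : ℕ
    D         : ℕ
    tail      : Fin D → Fin V
    rev       : Fin D → Fin D
    rev-invol : ∀ d → rev (rev d) ≡ d
    rev-nofix : ∀ d → rev d ≢ d

  Vertex : Set
  Vertex = Fin V

  Dart : Set
  Dart = Fin D

  head : Dart → Vertex
  head d = tail (rev d)

  DartsAt : Vertex → Set
  DartsAt v = Σ Dart (λ d → tail d ≡ v)

open Graph public

-- cubic: every vertex has exactly three incident darts (a loop counts twice)
Cubic : Graph → Set
Cubic G = ∀ (v : Vertex G) → DartsAt G v ↔ Fin 3

data Reach (G : Graph) : Vertex G → Vertex G → Set where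
  here : ∀ {v} → Reach G v v
  step : ∀ {u v} (d : Dart G) → tail G d ≡ u → Reach G (head G d) v → Reach G u v

Connected : Graph → Set
Connected G = ∀ (u v : Vertex G) → Reach G u v

-- cyclic successor on Fin (suc k): i ↦ i + 1 mod (suc k)

next : ∀ {k} → Fin (suc k) → Fin (suc k)
next {zero} _ = zero
next {suc k} zero = suc zero
next {suc k} (suc i) with next {k} i
... | zero = zero
... | suc j = suc (suc j)

record ClosedWalk (G : Graph) : Set where
  constructor walk
  field
    len    : ℕ                      -- number of steps is suc len
    dart   : Fin (suc len) → Dart G
    linked : ∀ i → head G (dart i) ≡ tail G (dart (next i))

open ClosedWalk public

module _ {G : Graph} (W : ClosedWalk G) where

  EdgeSpanning : Set
  EdgeSpanning = ∀ (d : Dart G) → ∃ λ i → (dart W i ≡ d) ⊎ (dart W i ≡ rev G d)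

  -- uses each edge at most once in each direction (each dart at most once)
  Orientable : Set
  Orientable = ∀ i j → dart W i ≡ dart W j → i ≡ j

  RetractionFree : Set
  RetractionFree = ∀ i → dart W (next i) ≢ rev G (dart W i)

-- Orientable cellular embeddings, combinatorially: rotation systems
-- (Heffter–Edmonds).

iterate : ∀ {A : Set} → (A → A) → ℕ → A → A
iterate f zero x = x
iterate f (suc n) x = f (iterate f n x)

record RotationSystem (G : Graph) : Set where
  field
    ρ        : Dart G → Dart G
    ρ⁻¹      : Dart G → Dart G
    ρ-inv₁   : ∀ d → ρ (ρ⁻¹ d) ≡ d
    ρ-inv₂   : ∀ d → ρ⁻¹ (ρ d) ≡ d
    ρ-tail   : ∀ d → tail G (ρ d) ≡ tail G d
    ρ-cyclic : ∀ d d' → tail G d ≡ tail G d' → ∃ λ n → iterate ρ n d ≡ d'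

  -- face permutation: after traversing d, leave its head along ρ (rev d)
  φ : Dart G → Dart G
  φ = ρ ∘ rev G

open RotationSystem public

IsFaceBoundary : {G : Graph} → RotationSystem G → ClosedWalk G → Set
IsFaceBoundary R W =
  (∀ i → dart W (next i) ≡ φ R (dart W i)) ×
  (∀ i j → dart W i ≡ dart W j → i ≡ j)

-- Cellular embeddings
-- exist exactly for connected G and then correspond to rotation systems.
ReporterStrandWalk : (G : Graph) → ClosedWalk G → Set
ReporterStrandWalk G W =
  Connected G × EdgeSpanning W × (Σ (RotationSystem G) λ R → IsFaceBoundary R W)

module Submission where

-- Number the three darts leaving each vertex by slots in Fin 3.  Every step
-- of W through a vertex v is a *turn* at v: it enters along the slot of the
-- reversed incoming dart and leaves along the slot of the next dart.
--
-- (⇒) A face boundary walk follows φ = ρ ∘ rev, and a rotation at a vertex of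
--     degree three has no fixed point, so the walk never turns back.
-- (⇐) The turns at v form a partial injection on the three slots (by
--     orientability), without fixed points (no retractions), meeting every
--     slot (edge-spanning).  On three slots such a partial injection turns
--     only forwards (slot ↦ slot + 1) or only backwards (slot ↦ slot - 1):
--     this is `no-mixed-turns`.  Choosing at each vertex the cyclic rotation
--     in the direction of its turns yields a rotation system whose face
--     permutation W follows.  An edge-spanning closed walk in a graph without
--     isolated vertices also witnesses connectivity.

open import Defs

open import Data.Bool using (Bool; true; false; not)
open import Data.Empty using (⊥; ⊥-elim)
open import Data.Fin using (Fin; zero; suc; inject₁; fromℕ)
open import Data.Fin.Induction using (<-weakInduction)
open import Data.Fin.Properties using (any?) renaming (_≟_ to _≟ᶠ_)
open import Data.Nat using (zero; suc)
open import Data.Product using (∃; _×_; _,_; proj₁; proj₂)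
open import Data.Sum using (_⊎_; inj₁; inj₂)
open import Function using (_∘′_)
open import Function.Bundles using (_⇔_; Inverse; mk⇔)
open import Relation.Nullary using (¬_; Dec; yes; no; does)
open import Relation.Nullary.Decidable using (_×-dec_)
open import Relation.Binary.PropositionalEquality
  using (_≡_; _≢_; refl; sym; trans; cong; cong₂; subst; module ≡-Reasoning)

prev : ∀ {k} → Fin (suc k) → Fin (suc k)
prev {k} zero = fromℕ k
prev {suc k} (suc i) = inject₁ i

next-inject₁ : ∀ {k} (i : Fin k) → next (inject₁ i) ≡ suc i
next-inject₁ {suc k} zero = refl
next-inject₁ {suc k} (suc i) rewrite next-inject₁ i = refl

next-fromℕ : ∀ k → next (fromℕ k) ≡ zero
next-fromℕ zero = refl
next-fromℕ (suc k) rewrite next-fromℕ k = refl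

next-prev : ∀ {k} (i : Fin (suc k)) → next (prev i) ≡ i
next-prev {k} zero = next-fromℕ k
next-prev {suc k} (suc i) = next-inject₁ i

prev-next : ∀ {k} (i : Fin (suc k)) → prev (next i) ≡ i
prev-next {zero} zero = refl
prev-next {suc k} zero = refl
prev-next {suc zero} (suc zero) = refl
prev-next {suc (suc k)} (suc i) with next i | prev-next i
... | zero  | e = cong suc e
... | suc j | e = cong suc e

next-injective : ∀ {k} {i j : Fin (suc k)} → next i ≡ next j → i ≡ j
next-injective {i = i} {j} e = trans (sym (prev-next i)) (trans (cong prev e) (prev-next j))

next≢id : ∀ (p : Fin 3) → next p ≢ p
next≢id zero ()
next≢id (suc zero) ()
next≢id (suc (suc zero)) ()

next²≢id : ∀ (p : Fin 3) → next (next p) ≢ p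
next²≢id zero ()
next²≢id (suc zero) ()
next²≢id (suc (suc zero)) ()

prev≡next² : ∀ (p : Fin 3) → prev p ≡ next (next p)
prev≡next² zero = refl
prev≡next² (suc zero) = refl
prev≡next² (suc (suc zero)) = refl

positions : ∀ (p q : Fin 3) → q ≡ p ⊎ q ≡ next p ⊎ q ≡ next (next p)
positions zero zero = inj₁ refl
positions zero (suc zero) = inj₂ (inj₁ refl)
positions zero (suc (suc zero)) = inj₂ (inj₂ refl)
positions (suc zero) zero = inj₂ (inj₂ refl)
positions (suc zero) (suc zero) = inj₁ refl
positions (suc zero) (suc (suc zero)) = inj₂ (inj₁ refl)
positions (suc (suc zero)) zero = inj₂ (inj₁ refl)
positions (suc (suc zero)) (suc zero) = inj₂ (inj₂ refl)
positions (suc (suc zero)) (suc (suc zero)) = inj₁ refl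

next≢prev : ∀ (p : Fin 3) → next p ≢ prev p
next≢prev p e = next≢id (next p) (sym (trans e (prev≡next² p)))

forwards-or-backwards : ∀ (p q : Fin 3) → q ≢ p → q ≡ next p ⊎ q ≡ prev p
forwards-or-backwards p q q≢p with positions p q
... | inj₁ q≡p = ⊥-elim (q≢p q≡p)
... | inj₂ (inj₁ e) = inj₁ e
... | inj₂ (inj₂ e) = inj₂ (trans e (sym (prev≡next² p)))

rotate : Bool → Fin 3 → Fin 3
rotate true = next
rotate false = prev

rotate-inverseˡ : ∀ b p → rotate b (rotate (not b) p) ≡ p
rotate-inverseˡ true = next-prev
rotate-inverseˡ false = prev-next

rotate-inverseʳ : ∀ b p → rotate (not b) (rotate b p) ≡ p
rotate-inverseʳ true = prev-next
rotate-inverseʳ false = next-prev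

rotate-cyclic : ∀ b p q → ∃ λ n → iterate (rotate b) n p ≡ q
rotate-cyclic true p q with positions p q
... | inj₁ e = 0 , sym e
... | inj₂ (inj₁ e) = 1 , sym e
... | inj₂ (inj₂ e) = 2 , sym e
rotate-cyclic false p q with positions p q
... | inj₁ e = 0 , sym e
... | inj₂ (inj₁ e) = 2 , trans (cong prev (prev≡next² p)) (trans (prev-next (next p)) (sym e))
... | inj₂ (inj₂ e) = 1 , trans (prev≡next² p) (sym e)

module PartialInjection
  (Turn       : Fin 3 → Fin 3 → Set)
  (functional : ∀ {a b b′} → Turn a b → Turn a b′ → b ≡ b′)
  (injective  : ∀ {a a′ b} → Turn a b → Turn a′ b → a ≡ a′)
  (no-U-turn  : ∀ {a} → ¬ Turn a a)
  (covering   : ∀ p → ∃ λ q → Turn p q ⊎ Turn q p)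
  where

  no-mixed-turns : ∀ {a b} → Turn a (next a) → Turn b (prev b) → ⊥
  no-mixed-turns {a} {b} a↦a+1 b↦b-1 = third-slot-missed (covering (next (next a)))
    where
    -- b cannot be a (that would turn a two ways), nor a + 2 (whose
    -- predecessor a + 1 is already hit by a), so b = a + 1 and b ↦ a.
    a+1↦a : Turn (next a) a
    a+1↦a with positions a b
    ... | inj₁ refl = ⊥-elim (next≢prev a (functional a↦a+1 b↦b-1))
    ... | inj₂ (inj₁ refl) = subst (Turn (next a)) (prev-next a) b↦b-1
    ... | inj₂ (inj₂ refl) =
      ⊥-elim (next²≢id a (injective (subst (Turn _) (prev-next (next a)) b↦b-1) a↦a+1))

    -- Both turns at the slot a + 2 would collide with a ↦ a+1 or a+1 ↦ a.
    third-slot-missed : (∃ λ q → Turn (next (next a)) q ⊎ Turn q (next (next a))) → ⊥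
    third-slot-missed (q , inj₁ t) with positions a q
    ... | inj₁ refl = next≢id (next a) (injective t a+1↦a)
    ... | inj₂ (inj₁ refl) = next²≢id a (injective t a↦a+1)
    ... | inj₂ (inj₂ refl) = no-U-turn t
    third-slot-missed (q , inj₂ t) with positions a q
    ... | inj₁ refl = next≢id (next a) (sym (functional a↦a+1 t))
    ... | inj₂ (inj₁ refl) = next²≢id a (sym (functional a+1↦a t))
    ... | inj₂ (inj₂ refl) = no-U-turn t

open PartialInjection using (no-mixed-turns)

rev-injective : ∀ (G : Graph) {a b : Dart G} → rev G a ≡ rev G b → a ≡ b
rev-injective G {a} {b} e = trans (sym (rev-invol G a)) (trans (cong (rev G) e) (rev-invol G b))

-- A rotation fixes no dart that shares its vertex with another dart,
-- because iterating a fixed point never leaves it.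
rotation-fixpoint-free : ∀ {G} (R : RotationSystem G) {x y : Dart G} →
  tail G x ≡ tail G y → x ≢ y → ρ R x ≢ x
rotation-fixpoint-free {G} R {x} {y} same-tail x≢y ρx≡x =
  x≢y (trans (sym (stays (proj₁ cycle))) (proj₂ cycle))
  where
  cycle : ∃ λ n → iterate (ρ R) n x ≡ y
  cycle = ρ-cyclic R x y same-tail
  stays : ∀ n → iterate (ρ R) n x ≡ x
  stays zero = refl
  stays (suc n) = trans (cong (ρ R) (stays n)) ρx≡x

module Reachability (G : Graph) where

  reach-trans : ∀ {u v w} → Reach G u v → Reach G v w → Reach G u w
  reach-trans here r = r
  reach-trans (step d t r) r′ = step d t (reach-trans r r′)

  -- Every dart can be traversed backwards along its reverse.
  reach-sym : ∀ {u v} → Reach G u v → Reach G v u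
  reach-sym here = here
  reach-sym {u} (step d refl r) = reach-trans (reach-sym r)
    (step (rev G d) refl (subst (λ z → Reach G z u) (sym (cong (tail G) (rev-invol G d))) here))

  spanning-walk-connected : (W : ClosedWalk G) → EdgeSpanning W →
    (∀ v → DartsAt G v) → Connected G
  spanning-walk-connected W spanning darts-at u v =
    reach-trans (reach-sym (reaches-dart (darts-at u))) (reaches-dart (darts-at v))
    where
    start : Vertex G
    start = tail G (dart W zero)

    visits : ∀ i → Reach G start (tail G (dart W i))
    visits = <-weakInduction (λ i → Reach G start (tail G (dart W i))) here
      λ i r → reach-trans r (step (dart W (inject₁ i)) refl
        (subst (Reach G (head G (dart W (inject₁ i))))
               (trans (linked W (inject₁ i)) (cong (tail G ∘′ dart W) (next-inject₁ i))) here))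

    -- the walk traverses every dart, outwards or inwards
    reaches-dart : ∀ {w} → DartsAt G w → Reach G start w
    reaches-dart (d , refl) with spanning d
    ... | i , inj₁ refl = visits i
    ... | i , inj₂ e = subst (Reach G start)
      (trans (sym (linked W i)) (cong (tail G) (trans (cong (rev G) e) (rev-invol G d))))
      (visits (next i))

module CubicGraph (G : Graph) (cubic : Cubic G) where

  slot : Dart G → Fin 3
  slot x = Inverse.to (cubic (tail G x)) (x , refl)

  dartAt : Vertex G → Fin 3 → Dart G
  dartAt v p = proj₁ (Inverse.from (cubic v) p)

  tail-dartAt : ∀ v p → tail G (dartAt v p) ≡ v
  tail-dartAt v p = proj₂ (Inverse.from (cubic v) p)

  dartAt-slot : ∀ x {v} → tail G x ≡ v → dartAt v (slot x) ≡ x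
  dartAt-slot x refl = cong proj₁ (Inverse.strictlyInverseʳ (cubic (tail G x)) (x , refl))

  slot-dartAt : ∀ v p → slot (dartAt v p) ≡ p
  slot-dartAt v p = trans (slot-at (tail-dartAt v p)) (Inverse.strictlyInverseˡ (cubic v) p)
    where
    slot-at : ∀ {y w} (e : tail G y ≡ w) → slot y ≡ Inverse.to (cubic w) (y , e)
    slot-at refl = refl

  slot-injective : ∀ {x y} → tail G x ≡ tail G y → slot x ≡ slot y → x ≡ y
  slot-injective {x} {y} same-tail same-slot =
    trans (sym (dartAt-slot x refl)) (trans (cong₂ dartAt same-tail same-slot) (dartAt-slot y refl))

  -- In a cubic graph no rotation has a fixed point: the dart in the next
  -- slot shares the vertex.
  rotation-no-fixpoint : (R : RotationSystem G) → ∀ x → ρ R x ≢ x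
  rotation-no-fixpoint R x = rotation-fixpoint-free R (sym (tail-dartAt (tail G x) _)) distinct
    where
    distinct : x ≢ dartAt (tail G x) (next (slot x))
    distinct e = next≢id (slot x) (sym (trans (cong slot e) (slot-dartAt _ _)))

  -- A cyclic order of the slots at every vertex is a rotation system:
  -- ρ moves each dart to the dart in the next slot of that order.
  module LocalRotation
    (σ σ⁻¹   : Vertex G → Fin 3 → Fin 3)
    (σ-σ⁻¹   : ∀ v p → σ v (σ⁻¹ v p) ≡ p)
    (σ⁻¹-σ   : ∀ v p → σ⁻¹ v (σ v p) ≡ p)
    (σ-cyclic : ∀ v p q → ∃ λ n → iterate (σ v) n p ≡ q)
    where

    rotationSystem : RotationSystem G
    rotationSystem = record
      { ρ = move σ
      ; ρ⁻¹ = move σ⁻¹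
      ; ρ-inv₁ = λ d → move-back σ σ⁻¹ σ-σ⁻¹ d
      ; ρ-inv₂ = λ d → move-back σ⁻¹ σ σ⁻¹-σ d
      ; ρ-tail = λ d → tail-dartAt (tail G d) _
      ; ρ-cyclic = cyclic
      }
      where
      open ≡-Reasoning

      move : (Vertex G → Fin 3 → Fin 3) → Dart G → Dart G
      move τ x = dartAt (tail G x) (τ (tail G x) (slot x))

      move-dartAt : ∀ τ v p → move τ (dartAt v p) ≡ dartAt v (τ v p)
      move-dartAt τ v p = cong₂ (λ w → dartAt w ∘′ τ w) (tail-dartAt v p) (slot-dartAt v p)

      move-back : ∀ τ τ′ → (∀ v p → τ v (τ′ v p) ≡ p) → ∀ x → move τ (move τ′ x) ≡ x
      move-back τ τ′ inverse x = begin
        move τ (dartAt v (τ′ v (slot x))) ≡⟨ move-dartAt τ v _ ⟩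
        dartAt v (τ v (τ′ v (slot x)))    ≡⟨ cong (dartAt v) (inverse v (slot x)) ⟩
        dartAt v (slot x)                 ≡⟨ dartAt-slot x refl ⟩
        x                                 ∎
        where
        v : Vertex G
        v = tail G x

      iterate-dartAt : ∀ v p n → iterate (move σ) n (dartAt v p) ≡ dartAt v (iterate (σ v) n p)
      iterate-dartAt v p zero = refl
      iterate-dartAt v p (suc n) = trans (cong (move σ) (iterate-dartAt v p n)) (move-dartAt σ v _)

      cyclic : ∀ x y → tail G x ≡ tail G y → ∃ λ n → iterate (move σ) n x ≡ y
      cyclic x y same-tail with σ-cyclic (tail G x) (slot x) (slot y)
      ... | n , reaches = n , (begin
        iterate (move σ) n x                                  ≡⟨ cong (iterate (move σ) n) (sym (dartAt-slot x refl)) ⟩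
        iterate (move σ) n (dartAt (tail G x) (slot x))       ≡⟨ iterate-dartAt (tail G x) (slot x) n ⟩
        dartAt (tail G x) (iterate (σ (tail G x)) n (slot x)) ≡⟨ cong (dartAt (tail G x)) reaches ⟩
        dartAt (tail G x) (slot y)                            ≡⟨ dartAt-slot y (sym same-tail) ⟩
        y                                                     ∎)

    ρ-slot : ∀ x → ρ rotationSystem x ≡ dartAt (tail G x) (σ (tail G x) (slot x))
    ρ-slot x = refl

  -- Step i ends at the vertex `turnAt i`,
  -- where W arrives through the slot `entry i` (of the reversed dart) and
  -- leaves through the slot `exit i` (of the following dart).
  module Turns (W : ClosedWalk G) where

    turnAt : Fin (suc (len W)) → Vertex G
    turnAt i = head G (dart W i)

    entry exit : Fin (suc (len W)) → Fin 3
    entry i = slot (rev G (dart W i))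
    exit i = slot (dart W (next i))

    tail-next : ∀ i → tail G (dart W (next i)) ≡ turnAt i
    tail-next i = sym (linked W i)

    Turn : Vertex G → Fin 3 → Fin 3 → Set
    Turn v a b = ∃ λ i → turnAt i ≡ v × entry i ≡ a × exit i ≡ b

    Backwards : Fin (suc (len W)) → Set
    Backwards i = exit i ≡ prev (entry i)

    BackwardsAt : Vertex G → Set
    BackwardsAt v = ∃ λ i → turnAt i ≡ v × Backwards i

    backwardsAt? : ∀ v → Dec (BackwardsAt v)
    backwardsAt? v = any? λ i → (turnAt i ≟ᶠ v) ×-dec (exit i ≟ᶠ prev (entry i))

    -- Rotate forwards at vertices with no backward turn, backwards elsewhere.
    orientation : Vertex G → Bool
    orientation v = not (does (backwardsAt? v))

    module _ (orientable : Orientable W) where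

      same-entry : ∀ {i j} → turnAt i ≡ turnAt j → entry i ≡ entry j → i ≡ j
      same-entry {i} {j} same-vertex e =
        orientable i j (rev-injective G (slot-injective same-vertex e))

      same-exit : ∀ {i j} → turnAt i ≡ turnAt j → exit i ≡ exit j → i ≡ j
      same-exit {i} {j} same-vertex e = next-injective (orientable (next i) (next j)
        (slot-injective (trans (tail-next i) (trans same-vertex (sym (tail-next j)))) e))

      turn-functional : ∀ {v a b b′} → Turn v a b → Turn v a b′ → b ≡ b′
      turn-functional (i , refl , refl , refl) (j , at-j , a-j , refl)
        with refl ← same-entry (sym at-j) (sym a-j) = refl

      turn-injective : ∀ {v a a′ b} → Turn v a b → Turn v a′ b → a ≡ a′
      turn-injective (i , refl , refl , refl) (j , at-j , refl , b-j)
        with refl ← same-exit (sym at-j) (sym b-j) = refl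

    no-U-turn : RetractionFree W → ∀ {v a} → ¬ Turn v a a
    no-U-turn retraction-free (i , _ , refl , e) =
      retraction-free i (slot-injective (tail-next i) e)

    -- Edge-spanning: the dart in slot p at v is traversed either outwards
    -- (the exit of the previous step) or inwards (the entry of the step).
    covering : EdgeSpanning W → ∀ v p → ∃ λ q → Turn v p q ⊎ Turn v q p
    covering spanning v p with spanning (dartAt v p)
    ... | i , inj₁ outwards = entry (prev i) , inj₂ (prev i , at , refl , exits)
      where
      leaves : dart W (next (prev i)) ≡ dartAt v p
      leaves = trans (cong (dart W) (next-prev i)) outwards
      at : turnAt (prev i) ≡ v
      at = trans (sym (tail-next (prev i))) (trans (cong (tail G) leaves) (tail-dartAt v p))
      exits : exit (prev i) ≡ p
      exits = trans (cong slot leaves) (slot-dartAt v p)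
    ... | i , inj₂ inwards = exit i , inj₁ (i , at , enters , refl)
      where
      arrives : rev G (dart W i) ≡ dartAt v p
      arrives = trans (cong (rev G) inwards) (rev-invol G _)
      at : turnAt i ≡ v
      at = trans (cong (tail G) arrives) (tail-dartAt v p)
      enters : entry i ≡ p
      enters = trans (cong slot arrives) (slot-dartAt v p)

    module FaceOfTurns
      (spanning        : EdgeSpanning W)
      (orientable      : Orientable W)
      (retraction-free : RetractionFree W)
      where

      turns-one-way : ∀ i j → turnAt i ≡ turnAt j → exit i ≡ next (entry i) → ¬ Backwards j
      turns-one-way i j same forwards backwards =
        no-mixed-turns (Turn (turnAt i)) (turn-functional orientable) (turn-injective orientable)
          (no-U-turn retraction-free) (covering spanning (turnAt i))
          (i , refl , refl , forwards) (j , sym same , refl , backwards)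

      turn-follows-orientation : ∀ i → exit i ≡ rotate (orientation (turnAt i)) (entry i)
      turn-follows-orientation i = follows (backwardsAt? (turnAt i))
        where
        direction : exit i ≡ next (entry i) ⊎ Backwards i
        direction = forwards-or-backwards (entry i) (exit i)
          λ e → no-U-turn retraction-free (i , refl , refl , e)

        follows : (d : Dec (BackwardsAt (turnAt i))) → exit i ≡ rotate (not (does d)) (entry i)
        follows (yes (j , at-j , backwards-j)) with direction
        ... | inj₁ forwards = ⊥-elim (turns-one-way i j (sym at-j) forwards backwards-j)
        ... | inj₂ backwards = backwards
        follows (no no-backwards) with direction
        ... | inj₁ forwards = forwards
        ... | inj₂ backwards = ⊥-elim (no-backwards (i , refl , backwards))

      open LocalRotation (λ v → rotate (orientation v)) (λ v → rotate (not (orientation v)))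
        (λ v → rotate-inverseˡ (orientation v)) (λ v → rotate-inverseʳ (orientation v))
        (λ v → rotate-cyclic (orientation v)) public

      follows-face : IsFaceBoundary rotationSystem W
      follows-face = follows-φ , orientable
        where
        open ≡-Reasoning
        follows-φ : ∀ i → dart W (next i) ≡ φ rotationSystem (dart W i)
        follows-φ i = begin
          dart W (next i)                                             ≡⟨ sym (dartAt-slot _ (tail-next i)) ⟩
          dartAt (turnAt i) (exit i)                                  ≡⟨ cong (dartAt (turnAt i)) (turn-follows-orientation i) ⟩
          dartAt (turnAt i) (rotate (orientation (turnAt i)) (entry i)) ≡⟨ sym (ρ-slot (rev G (dart W i))) ⟩
          φ rotationSystem (dart W i)                                 ∎

lemma3p2 : (G : Graph) → Cubic G → (W : ClosedWalk G) →
    ReporterStrandWalk G W ⇔ (EdgeSpanning W × Orientable W × RetractionFree W)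
lemma3p2 G cubic W = mk⇔ necessary sufficient
  where
  open CubicGraph G cubic
  open Turns W
  open Reachability G using (spanning-walk-connected)

  -- A face boundary walk follows φ, so a retraction would be a fixed point of ρ.
  necessary : ReporterStrandWalk G W → EdgeSpanning W × Orientable W × RetractionFree W
  necessary (_ , spanning , R , follows-φ , orientable) =
    spanning , orientable ,
    λ i retraction → rotation-no-fixpoint R (rev G (dart W i)) (trans (sym (follows-φ i)) retraction)

  sufficient : EdgeSpanning W × Orientable W × RetractionFree W → ReporterStrandWalk G W
  sufficient (spanning , orientable , retraction-free) =
    spanning-walk-connected W spanning (λ v → dartAt v zero , tail-dartAt v zero) ,
    spanning , rotationSystem , follows-face
    where open FaceOfTurns spanning orientable retraction-free
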